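{- Let $M$ be a matroid of rank 2 with ground set $[n]$. If $M$ has no minor isomorphic to $U_{2,k}$, then $\kappa(M)\le k$.
   Context: $U_{2,k}$ is the uniform matroid of rank 2 on $k$ elements. A non-basis of $M$ is a set of size $r(M)$ that is not a basis. A flat $F$ covers $X$ if $|X\cap F|>r_M(F)$. A flat cover of $M$ is a set of flats such that every non-basis is covered by some member; $\kappa(M)$ is the minimum size of a flat cover. -}

module Defs where

open import Data.Nat using (ℕ; _≤_; _<_; _∸_; _⊔_; _⊓_; _+_)
open import Data.Fin using (Fin)
open import Data.Fin.Subset using (Subset; ∣_∣; _∪_; _∩_; _⊆_; _∈_; _∉_; ⊤; ⁅_⁆; ∁; Empty)
open import Data.Vec using (tabulate; lookup)
open import Data.List using (List; length)
open import Data.List.Relation.Unary.All using (All)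
open import Data.List.Relation.Unary.Any using (Any)
open import Data.Product using (Σ; _×_; ∃; ∃-syntax)
open import Relation.Binary.PropositionalEquality using (_≡_)
open import Relation.Nullary using (¬_)
open import Function.Definitions using (Injective)

record Matroid (n : ℕ) : Set where
  field
    r          : Subset n → ℕ
    r-bounded  : ∀ X → r X ≤ ∣ X ∣
    r-mono     : ∀ {X Y} → X ⊆ Y → r X ≤ r Y
    r-submod   : ∀ X Y → r (X ∪ Y) + r (X ∩ Y) ≤ r X + r Y

open Matroid public

rk : ∀ {n} → Matroid n → ℕ
rk M = r M ⊤

IsBasis : ∀ {n} → Matroid n → Subset n → Set
IsBasis M X = (r M X ≡ ∣ X ∣) × (∣ X ∣ ≡ rk M)

IsNonBasis : ∀ {n} → Matroid n → Subset n → Set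
IsNonBasis M X = (∣ X ∣ ≡ rk M) × ¬ IsBasis M X

IsFlat : ∀ {n} → Matroid n → Subset n → Set
IsFlat M F = ∀ e → e ∉ F → r M F < r M (F ∪ ⁅ e ⁆)

Covers : ∀ {n} → Matroid n → Subset n → Subset n → Set
Covers M F X = r M F < ∣ X ∩ F ∣

IsFlatCover : ∀ {n} → Matroid n → List (Subset n) → Set
IsFlatCover M Fs = All (IsFlat M) Fs × (∀ X → IsNonBasis M X → Any (λ F → Covers M F X) Fs)

κ≤ : ∀ {n} → Matroid n → ℕ → Set
κ≤ M k = ∃[ Fs ] (IsFlatCover M Fs × length Fs ≤ k)

rankU2 : ∀ {k} → Subset k → ℕ
rankU2 X = 2 ⊓ ∣ X ∣

-- rank function of the minor M / C \ D (on subsets of E - (C ∪ D))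
minorRank : ∀ {n} → Matroid n → Subset n → Subset n → ℕ
minorRank M C Y = r M (Y ∪ C) ∸ r M C

preimage : ∀ {k n} → (Fin k → Fin n) → Subset n → Subset k
preimage f Y = tabulate (λ j → lookup Y (f j))

-- M has a minor M / C \ D (C, D disjoint) isomorphic to U_{2,k}:
-- f : Fin k → E - (C ∪ D) is a bijection, and for every Y ⊆ E - (C ∪ D),
-- the rank of Y in M / C \ D equals the U_{2,k}-rank of f⁻¹(Y).
HasU2Minor : ∀ {n} → Matroid n → ℕ → Set
HasU2Minor {n} M k =
  Σ (Subset n) λ C → Σ (Subset n) λ D → Σ (Fin k → Fin n) λ f →
    Empty (C ∩ D)
  × Injective _≡_ _≡_ f
  × (∀ j → f j ∉ (C ∪ D))
  × (∀ i → i ∉ (C ∪ D) → ∃[ j ] (f j ≡ i))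
  × (∀ Y → Y ⊆ ∁ (C ∪ D) → minorRank M C Y ≡ rankU2 (preimage f Y))

-- In a rank-2 matroid the loops form a flat of rank 0, and the parallel class of
-- each non-loop is a flat of rank 1. A non-basis is a pair of rank at most 1, so
-- it either contains a loop or lies inside a single parallel class; hence the
-- loops together with the m parallel classes form a flat cover of size 1 + m.
-- Conversely, one representative from each class gives m points any two of which
-- have rank 2, and restricting M to them is U_{2,m}. So if M has no U_{2,k}
-- minor then m < k and κ(M) ≤ k.
module Submission where

open import Defs
open import Data.Nat using (ℕ; suc; _≤_; _<_; _⊓_; _+_; _∸_; s≤s; s≤s⁻¹; _≤?_; _≟_)
open import Data.Nat.Properties
  using ( ≤-refl; ≤-reflexive; ≤-trans; ≤-antisym; +-cancelʳ-≤; +-mono-≤; +-monoʳ-≤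
        ; n≤0⇒n≡0; ≰⇒>; ≤∧≢⇒<; 0≢1+n; n≢0⇒n>0; m≤n⇒m⊓n≡m)
open import Data.Fin using (Fin; inject≤)
import Data.Fin as Fin
open import Data.Fin.Properties using (any?; inject≤-injective)
open import Data.Fin.Subset using (Subset; ∣_∣; _∪_; _∩_; _⊆_; _∈_; _∉_; ⊥; ⁅_⁆; ∁; ⋃; Empty)
open import Data.Fin.Subset.Properties
  using ( _∈?_; nonempty?; ∉⊥; ∈⊤; x∈⁅x⁆; x∈⁅y⁆⇒x≡y; x≢y⇒x∉⁅y⁆; ⊆-refl; ⊆-antisym; Empty-unique
        ; x∈∁p⇒x∉p; x∉∁p⇒x∈p; p∩q⊆p; p⊆p∪q; q⊆p∪q; x∈p∪q⁻; x∈p∩q⁺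
        ; ∪-comm; ∪-identityˡ; ∪-identityʳ
        ; ∣⊥∣≡0; ∣⁅x⁆∣≡1; p⊆q⇒∣p∣≤∣q∣; p⊂q⇒∣p∣<∣q∣)
open import Data.Vec using (tabulate; lookup)
open import Data.Vec.Properties using (lookup∘tabulate; []=⇒lookup; lookup⇒[]=)
open import Data.List using (List; []; _∷_; length; map; filter; allFin)
import Data.List as List
open import Data.List.Properties using (length-map)
open import Data.List.Relation.Unary.All using (All; []; _∷_)
import Data.List.Relation.Unary.All as All
open import Data.List.Relation.Unary.All.Properties using (¬Any⇒All¬; all-filter)
import Data.List.Relation.Unary.All.Properties as All
open import Data.List.Relation.Unary.Any using (Any; here; there)
import Data.List.Relation.Unary.Any as Any
import Data.List.Relation.Unary.Any.Properties as Any
open import Data.List.Relation.Unary.AllPairs using (AllPairs; []; _∷_)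
open import Data.List.Relation.Binary.Subset.Propositional using () renaming (_⊆_ to _⊆ˡ_)
open import Data.List.Membership.Propositional using (find; lose) renaming (_∈_ to _∈ˡ_)
open import Data.List.Membership.Propositional.Properties
  using (∈-allFin; ∈-filter⁺; ∈-filter⁻; ∈-map⁺; ∈-lookup)
open import Data.Product using (_×_; _,_; proj₁; proj₂; ∃₂; ∃-syntax)
open import Data.Sum using (_⊎_; inj₁; inj₂; [_,_])
open import Data.Empty using (⊥-elim)
open import Function using (_∘_)
open import Function.Definitions using (Injective)
open import Relation.Binary.Definitions using (Symmetric; Reflexive) renaming (Decidable to Decidable₂)
open import Relation.Binary.PropositionalEquality using (_≡_; _≢_; refl; sym; trans; cong; cong₂; subst; subst₂)
open import Relation.Nullary using (¬_; yes; no; does; ¬?)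
open import Relation.Nullary.Decidable using (dec-true; _×-dec_)
open import Relation.Unary using (Decidable)

module _ {n : ℕ} {P : Fin n → Set} (P? : Decidable P) where

  select : Subset n
  select = tabulate (does ∘ P?)

  ∈-select⁺ : ∀ {x} → P x → x ∈ select
  ∈-select⁺ {x} px = lookup⇒[]= x select (trans (lookup∘tabulate (does ∘ P?) x) (dec-true (P? x) px))

  ∈-select⁻ : ∀ {x} → x ∈ select → P x
  ∈-select⁻ {x} x∈ with P? x | trans (sym (lookup∘tabulate (does ∘ P?) x)) ([]=⇒lookup x∈)
  ... | yes px | _ = px
  ... | no _   | ()

module _ {n : ℕ} where

  ∪-lub : {p q s : Subset n} → p ⊆ s → q ⊆ s → p ∪ q ⊆ s
  ∪-lub {p} {q} p⊆s q⊆s x∈ with x∈p∪q⁻ p q x∈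
  ... | inj₁ x∈p = p⊆s x∈p
  ... | inj₂ x∈q = q⊆s x∈q

  x∈p⇒⁅x⁆⊆p : {x : Fin n} {p : Subset n} → x ∈ p → ⁅ x ⁆ ⊆ p
  x∈p⇒⁅x⁆⊆p {x} x∈p y∈⁅x⁆ = subst (_∈ _) (sym (x∈⁅y⁆⇒x≡y x y∈⁅x⁆)) x∈p

  ∈-⋃⁺ : {x : Fin n} {ps : List (Subset n)} → Any (x ∈_) ps → x ∈ ⋃ ps
  ∈-⋃⁺ (here x∈p)  = p⊆p∪q _ x∈p
  ∈-⋃⁺ (there x∈⋃) = q⊆p∪q _ _ (∈-⋃⁺ x∈⋃)

  ⊆-⋃-singletons : (p : Subset n) → p ⊆ ⋃ (map ⁅_⁆ (filter (_∈? p) (allFin n)))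
  ⊆-⋃-singletons p {x} x∈p =
    ∈-⋃⁺ (Any.map⁺ (Any.map (λ { refl → x∈⁅x⁆ x }) (∈-filter⁺ (_∈? p) (∈-allFin x) x∈p)))

  subset-trichotomy : (p : Subset n) →
    Empty p ⊎ (∃[ j ] p ≡ ⁅ j ⁆) ⊎ (∃₂ λ i j → i ≢ j × i ∈ p × j ∈ p)
  subset-trichotomy p with nonempty? p
  ... | no empty = inj₁ empty
  ... | yes (j , j∈p) with any? (λ i → (i ∈? p) ×-dec ¬? (i Fin.≟ j))
  ...   | yes (i , i∈p , i≢j) = inj₂ (inj₂ (i , j , i≢j , i∈p , j∈p))
  ...   | no onlyJ = inj₂ (inj₁ (j , ⊆-antisym p⊆⁅j⁆ (x∈p⇒⁅x⁆⊆p j∈p)))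
    where
    p⊆⁅j⁆ : p ⊆ ⁅ j ⁆
    p⊆⁅j⁆ {i} i∈p with i Fin.≟ j
    ... | yes refl = x∈⁅x⁆ j
    ... | no i≢j   = ⊥-elim (onlyJ (i , i∈p , i≢j))

  Empty⇒∣p∣≡0 : {p : Subset n} → Empty p → ∣ p ∣ ≡ 0
  Empty⇒∣p∣≡0 empty = trans (cong ∣_∣ (Empty-unique empty)) (∣⊥∣≡0 n)

  distinct⇒2≤∣p∣ : {p : Subset n} {i j : Fin n} → i ≢ j → i ∈ p → j ∈ p → 2 ≤ ∣ p ∣
  distinct⇒2≤∣p∣ {p} {i} {j} i≢j i∈p j∈p =
    subst (_< ∣ p ∣) (∣⁅x⁆∣≡1 i)
          (p⊂q⇒∣p∣<∣q∣ (x∈p⇒⁅x⁆⊆p i∈p , j , j∈p , x≢y⇒x∉⁅y⁆ (i≢j ∘ sym)))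

module _ {k n : ℕ} (f : Fin k → Fin n) where

  image : Subset n
  image = select (λ x → any? (λ j → f j Fin.≟ x))

  ∈-image⁺ : (j : Fin k) → f j ∈ image
  ∈-image⁺ j = ∈-select⁺ (λ x → any? (λ j → f j Fin.≟ x)) (j , refl)

  ∈-image⁻ : {x : Fin n} → x ∈ image → ∃[ j ] (f j ≡ x)
  ∈-image⁻ = ∈-select⁻ (λ x → any? (λ j → f j Fin.≟ x))

  ∈-preimage⁺ : {Y : Subset n} {j : Fin k} → f j ∈ Y → j ∈ preimage f Y
  ∈-preimage⁺ {Y} {j} fj∈Y = lookup⇒[]= j _ (trans (lookup∘tabulate (lookup Y ∘ f) j) ([]=⇒lookup fj∈Y))

  ∈-preimage⁻ : {Y : Subset n} {j : Fin k} → j ∈ preimage f Y → f j ∈ Y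
  ∈-preimage⁻ {Y} {j} j∈ =
    lookup⇒[]= (f j) Y (trans (sym (lookup∘tabulate (lookup Y ∘ f) j)) ([]=⇒lookup j∈))

  ∈-image-preimage : {Y : Subset n} {y : Fin n} → Y ⊆ image → y ∈ Y →
                     ∃[ j ] (j ∈ preimage f Y × f j ≡ y)
  ∈-image-preimage Y⊆image y∈Y with ∈-image⁻ (Y⊆image y∈Y)
  ... | j , refl = j , ∈-preimage⁺ y∈Y , refl

module _ {A : Set} {R : A → A → Set} (R? : Decidable₂ R) (R-sym : Symmetric R) (R-refl : Reflexive R) where

  representativeSublist : (xs : List A) →
    ∃[ ys ] (ys ⊆ˡ xs × AllPairs (λ a b → ¬ R a b) ys × (∀ {x} → x ∈ˡ xs → Any (λ y → R y x) ys))
  representativeSublist [] = [] , (λ ()) , [] , (λ ())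
  representativeSublist (x ∷ xs) with representativeSublist xs
  ... | ys , ys⊆xs , unrelated , represented with Any.any? (λ y → R? y x) ys
  ...   | yes x-represented = ys , there ∘ ys⊆xs , unrelated , λ where
          (here refl)  → x-represented
          (there x∈xs) → represented x∈xs
  ...   | no x-new =
          x ∷ ys
          , (λ where
              (here refl)  → here refl
              (there y∈ys) → there (ys⊆xs y∈ys))
          , All.map (λ ¬Ryx Rxy → ¬Ryx (R-sym Rxy)) (¬Any⇒All¬ ys x-new) ∷ unrelated
          , (λ where
              (here refl)  → here R-refl
              (there x∈xs) → there (represented x∈xs))

AllPairs-lookup : {A : Set} {R : A → A → Set} → Symmetric R → {xs : List A} → AllPairs R xs →
                  {i j : Fin (length xs)} → i ≢ j → R (List.lookup xs i) (List.lookup xs j)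
AllPairs-lookup R-sym (Rx ∷ _) {Fin.zero} {Fin.zero} i≢j = ⊥-elim (i≢j refl)
AllPairs-lookup R-sym (Rx ∷ _) {Fin.zero} {Fin.suc j} _ = All.lookup Rx (∈-lookup j)
AllPairs-lookup R-sym (Rx ∷ _) {Fin.suc i} {Fin.zero} _ = R-sym (All.lookup Rx (∈-lookup i))
AllPairs-lookup R-sym (_ ∷ Rxs) {Fin.suc i} {Fin.suc j} i≢j = AllPairs-lookup R-sym Rxs (i≢j ∘ cong Fin.suc)

submodular-bound : ∀ {a b x y c} → a + b ≤ x + y → x ≤ c → y ≤ c → c ≤ b → a ≤ c
submodular-bound {a} {b} {x} {y} {c} sub x≤c y≤c c≤b =
  +-cancelʳ-≤ c a c (≤-trans (+-monoʳ-≤ a c≤b) (≤-trans sub (+-mono-≤ x≤c y≤c)))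

module _ {n : ℕ} (M : Matroid n) where

  r-⊥ : r M ⊥ ≡ 0
  r-⊥ = n≤0⇒n≡0 (subst (r M ⊥ ≤_) (∣⊥∣≡0 n) (r-bounded M ⊥))

  r-⁅x⁆≤1 : ∀ x → r M ⁅ x ⁆ ≤ 1
  r-⁅x⁆≤1 x = subst (r M ⁅ x ⁆ ≤_) (∣⁅x⁆∣≡1 x) (r-bounded M ⁅ x ⁆)

  r≤rk : ∀ X → r M X ≤ rk M
  r≤rk X = r-mono M (λ _ → ∈⊤)

  nonBasis⇒r<∣X∣ : ∀ {X} → IsNonBasis M X → r M X < ∣ X ∣
  nonBasis⇒r<∣X∣ {X} (∣X∣≡rk , notBasis) with r-bounded M X | r M X ≟ ∣ X ∣
  ... | _     | yes r≡∣X∣ = ⊥-elim (notBasis (r≡∣X∣ , ∣X∣≡rk))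
  ... | r≤∣X∣ | no r≢∣X∣  = ≤∧≢⇒< r≤∣X∣ r≢∣X∣

  Spans : Subset n → Subset n → Set
  Spans S A = r M (S ∪ A) ≤ r M S

  spans-∪ : ∀ {S A B} → Spans S A → Spans S B → Spans S (A ∪ B)
  spans-∪ {S} {A} {B} SA SB =
    ≤-trans (r-mono M S∪[A∪B]⊆) (submodular-bound (r-submod M (S ∪ A) (S ∪ B)) SA SB (r-mono M S⊆∩))
    where
    S∪[A∪B]⊆ : S ∪ (A ∪ B) ⊆ (S ∪ A) ∪ (S ∪ B)
    S∪[A∪B]⊆ = ∪-lub (p⊆p∪q _ ∘ p⊆p∪q A) (∪-lub (p⊆p∪q _ ∘ q⊆p∪q S A) (q⊆p∪q _ _ ∘ q⊆p∪q S B))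
    S⊆∩ : S ⊆ (S ∪ A) ∩ (S ∪ B)
    S⊆∩ x∈S = x∈p∩q⁺ (p⊆p∪q A x∈S , p⊆p∪q B x∈S)

  spans-⋃ : ∀ {S} (As : List (Subset n)) → All (Spans S) As → Spans S (⋃ As)
  spans-⋃ {S} [] [] = subst (λ T → r M T ≤ r M S) (sym (∪-identityʳ S)) (r-mono M ⊆-refl)
  spans-⋃ (A ∷ As) (SA ∷ SAs) = spans-∪ SA (spans-⋃ As SAs)

  spans : ∀ {S T} → (∀ {x} → x ∈ T → Spans S ⁅ x ⁆) → Spans S T
  spans {S} {T} spansPoints =
    ≤-trans (r-mono M (∪-lub (p⊆p∪q _) (q⊆p∪q S _ ∘ ⊆-⋃-singletons T)))
            (spans-⋃ _ (All.map⁺ (All.map spansPoints (all-filter (_∈? T) (allFin n)))))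

  Loop : Fin n → Set
  Loop x = r M ⁅ x ⁆ ≡ 0

  loop? : Decidable Loop
  loop? x = r M ⁅ x ⁆ ≟ 0

  NonLoop : Fin n → Set
  NonLoop x = 1 ≤ r M ⁅ x ⁆

  -- Unlike the usual notion, a loop is parallel to everything; only non-loops matter below.
  Parallel : Fin n → Fin n → Set
  Parallel a b = r M (⁅ a ⁆ ∪ ⁅ b ⁆) ≤ 1

  parallel? : Decidable₂ Parallel
  parallel? a b = r M (⁅ a ⁆ ∪ ⁅ b ⁆) ≤? 1

  parallel-refl : Reflexive Parallel
  parallel-refl {a} = ≤-trans (r-mono M (∪-lub ⊆-refl ⊆-refl)) (r-⁅x⁆≤1 a)

  parallel-sym : Symmetric Parallel
  parallel-sym {a} {b} = subst (λ X → r M X ≤ 1) (∪-comm ⁅ a ⁆ ⁅ b ⁆)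

  loops : Subset n
  loops = select loop?

  r-loops : r M loops ≡ 0
  r-loops = n≤0⇒n≡0 (subst₂ _≤_ (cong (r M) (∪-identityˡ loops)) r-⊥ (spans spansLoop))
    where
    spansLoop : ∀ {x} → x ∈ loops → Spans ⊥ ⁅ x ⁆
    spansLoop {x} x∈loops =
      subst₂ _≤_ (cong (r M) (sym (∪-identityˡ ⁅ x ⁆)))
                 (trans (∈-select⁻ loop? x∈loops) (sym r-⊥)) ≤-refl

  loops-flat : IsFlat M loops
  loops-flat e e∉loops =
    subst (_< r M (loops ∪ ⁅ e ⁆)) (sym r-loops)
          (≤-trans (n≢0⇒n>0 (e∉loops ∘ ∈-select⁺ loop?)) (r-mono M (q⊆p∪q loops ⁅ e ⁆)))

  loops-covers : ∀ {X x} → x ∈ X → Loop x → Covers M loops X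
  loops-covers {X} {x} x∈X loop =
    subst (_< ∣ X ∩ loops ∣) (sym r-loops)
          (subst (_≤ ∣ X ∩ loops ∣) (∣⁅x⁆∣≡1 x)
                 (p⊆q⇒∣p∣≤∣q∣ (x∈p⇒⁅x⁆⊆p (x∈p∩q⁺ (x∈X , ∈-select⁺ loop? loop)))))

  parallelClass : Fin n → Subset n
  parallelClass ρ = select (parallel? ρ)

  r-parallelClass : ∀ {ρ} → NonLoop ρ → r M (parallelClass ρ) ≤ 1
  r-parallelClass {ρ} nonLoop =
    ≤-trans (r-mono M (q⊆p∪q ⁅ ρ ⁆ _))
            (≤-trans (spans (λ x∈class → ≤-trans (∈-select⁻ (parallel? ρ) x∈class) nonLoop)) (r-⁅x⁆≤1 ρ))

  parallelClass-flat : ∀ {ρ} → NonLoop ρ → IsFlat M (parallelClass ρ)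
  parallelClass-flat {ρ} nonLoop e e∉class =
    ≤-trans (s≤s (r-parallelClass nonLoop))
            (≤-trans (≰⇒> (e∉class ∘ ∈-select⁺ (parallel? ρ)))
                     (r-mono M (∪-lub (p⊆p∪q _ ∘ x∈p⇒⁅x⁆⊆p ρ∈class) (q⊆p∪q _ _))))
    where
    ρ∈class : ρ ∈ parallelClass ρ
    ρ∈class = ∈-select⁺ (parallel? ρ) parallel-refl

  -- A rank-1 set X through a non-loop a is spanned by a, and so is any ρ parallel to a.
  ⊆-parallelClass : ∀ {X a ρ} → r M X ≤ 1 → a ∈ X → NonLoop a → Parallel ρ a → X ⊆ parallelClass ρ
  ⊆-parallelClass {X} {a} {ρ} rX≤1 a∈X nonLoop ρ∥a {b} b∈X =
    ∈-select⁺ (parallel? ρ) (≤-trans (r-mono M ρb⊆) (≤-trans (spans-∪ spansρ spansX) (r-⁅x⁆≤1 a)))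
    where
    spansρ : Spans ⁅ a ⁆ ⁅ ρ ⁆
    spansρ = ≤-trans (parallel-sym ρ∥a) nonLoop
    spansX : Spans ⁅ a ⁆ X
    spansX = ≤-trans (r-mono M (∪-lub (x∈p⇒⁅x⁆⊆p a∈X) ⊆-refl)) (≤-trans rX≤1 nonLoop)
    ρb⊆ : ⁅ ρ ⁆ ∪ ⁅ b ⁆ ⊆ ⁅ a ⁆ ∪ (⁅ ρ ⁆ ∪ X)
    ρb⊆ = ∪-lub (q⊆p∪q _ _ ∘ p⊆p∪q X) (q⊆p∪q _ _ ∘ q⊆p∪q ⁅ ρ ⁆ X ∘ x∈p⇒⁅x⁆⊆p b∈X)

  parallelClass-covers : ∀ {X ρ} → NonLoop ρ → 2 ≤ ∣ X ∣ → X ⊆ parallelClass ρ →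
                         Covers M (parallelClass ρ) X
  parallelClass-covers {X} nonLoop 2≤∣X∣ X⊆class =
    ≤-trans (s≤s (r-parallelClass nonLoop))
            (≤-trans 2≤∣X∣ (p⊆q⇒∣p∣≤∣q∣ (λ x∈X → x∈p∩q⁺ (x∈X , X⊆class x∈X))))

  nonLoop? : Decidable NonLoop
  nonLoop? x = 1 ≤? r M ⁅ x ⁆

  record ParallelClassRepresentatives : Set where
    field
      reps        : List (Fin n)
      nonLoop     : All NonLoop reps
      nonParallel : AllPairs (λ a b → ¬ Parallel a b) reps
      represent   : ∀ {x} → NonLoop x → Any (λ ρ → Parallel ρ x) reps

  representatives : ParallelClassRepresentatives
  representatives with representativeSublist parallel? parallel-sym parallel-refl (filter nonLoop? (allFin n))
  ... | reps , reps⊆nonLoops , nonParallel , represented = record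
    { reps        = reps
    ; nonLoop     = All.tabulate (proj₂ ∘ ∈-filter⁻ nonLoop? {xs = allFin n} ∘ reps⊆nonLoops)
    ; nonParallel = nonParallel
    ; represent   = λ {x} nonLoop → represented (∈-filter⁺ nonLoop? (∈-allFin x) nonLoop)
    }

  restriction-U2Minor : ∀ {k} (f : Fin k → Fin n) → Injective _≡_ _≡_ f →
                        (∀ Y → Y ⊆ image f → r M Y ≡ rankU2 (preimage f Y)) → HasU2Minor M k
  restriction-U2Minor f f-injective rank =
    ⊥ , ∁ (image f) , f , ⊥∩-empty , f-injective , ∈image⇒outside ∘ ∈-image⁺ f
    , (λ _ → ∈-image⁻ f ∘ outside⇒∈image) , minorRank≡
    where
    ⊥∩-empty : Empty (⊥ ∩ ∁ (image f))
    ⊥∩-empty (x , x∈) = ∉⊥ (p∩q⊆p ⊥ _ x∈)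
    outside⇒∈image : ∀ {x} → x ∉ ⊥ ∪ ∁ (image f) → x ∈ image f
    outside⇒∈image x∉ = x∉∁p⇒x∈p (x∉ ∘ q⊆p∪q ⊥ _)
    ∈image⇒outside : ∀ {x} → x ∈ image f → x ∉ ⊥ ∪ ∁ (image f)
    ∈image⇒outside x∈image x∈ = [ ∉⊥ , (λ x∈∁ → x∈∁p⇒x∉p x∈∁ x∈image) ] (x∈p∪q⁻ ⊥ _ x∈)
    minorRank≡ : ∀ Y → Y ⊆ ∁ (⊥ ∪ ∁ (image f)) → minorRank M ⊥ Y ≡ rankU2 (preimage f Y)
    minorRank≡ Y Y⊆ = trans (cong₂ _∸_ (cong (r M) (∪-identityʳ Y)) r-⊥)
                            (rank Y (outside⇒∈image ∘ x∈∁p⇒x∉p ∘ Y⊆))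

  module _ {k} (f : Fin k → Fin n) (nonParallel : ∀ {i j} → i ≢ j → ¬ Parallel (f i) (f j)) where

    nonParallel⇒injective : Injective _≡_ _≡_ f
    nonParallel⇒injective {i} {j} fi≡fj with i Fin.≟ j
    ... | yes i≡j = i≡j
    ... | no i≢j  = ⊥-elim (nonParallel i≢j (subst (Parallel (f i)) fi≡fj parallel-refl))

    r≡rankU2-preimage : rk M ≡ 2 → (∀ j → NonLoop (f j)) →
                        ∀ Y → Y ⊆ image f → r M Y ≡ rankU2 (preimage f Y)
    r≡rankU2-preimage rk≡2 nonLoop Y Y⊆image with subset-trichotomy (preimage f Y)
    ... | inj₁ empty =
      trans (n≤0⇒n≡0 (subst (r M Y ≤_) r-⊥ (r-mono M Y⊆⊥))) (cong (2 ⊓_) (sym (Empty⇒∣p∣≡0 empty)))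
      where
      Y⊆⊥ : Y ⊆ ⊥
      Y⊆⊥ y∈Y with ∈-image-preimage f Y⊆image y∈Y
      ... | j , j∈P , refl = ⊥-elim (empty (j , j∈P))
    ... | inj₂ (inj₁ (j , P≡⁅j⁆)) =
      trans r≡1 (cong (2 ⊓_) (sym (trans (cong ∣_∣ P≡⁅j⁆) (∣⁅x⁆∣≡1 j))))
      where
      fj∈Y : f j ∈ Y
      fj∈Y = ∈-preimage⁻ f (subst (j ∈_) (sym P≡⁅j⁆) (x∈⁅x⁆ j))
      Y⊆⁅fj⁆ : Y ⊆ ⁅ f j ⁆
      Y⊆⁅fj⁆ y∈Y with ∈-image-preimage f Y⊆image y∈Y
      ... | i , i∈P , refl =
        subst (λ i → f i ∈ ⁅ f j ⁆) (sym (x∈⁅y⁆⇒x≡y j (subst (i ∈_) P≡⁅j⁆ i∈P))) (x∈⁅x⁆ (f j))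
      r≡1 : r M Y ≡ 1
      r≡1 = ≤-antisym (≤-trans (r-mono M Y⊆⁅fj⁆) (r-⁅x⁆≤1 (f j)))
                      (≤-trans (nonLoop j) (r-mono M (x∈p⇒⁅x⁆⊆p fj∈Y)))
    ... | inj₂ (inj₂ (i , j , i≢j , i∈P , j∈P)) =
      trans r≡2 (sym (m≤n⇒m⊓n≡m (distinct⇒2≤∣p∣ i≢j i∈P j∈P)))
      where
      fifj⊆Y : ⁅ f i ⁆ ∪ ⁅ f j ⁆ ⊆ Y
      fifj⊆Y = ∪-lub (x∈p⇒⁅x⁆⊆p (∈-preimage⁻ f i∈P)) (x∈p⇒⁅x⁆⊆p (∈-preimage⁻ f j∈P))
      r≡2 : r M Y ≡ 2
      r≡2 = ≤-antisym (subst (r M Y ≤_) rk≡2 (r≤rk Y))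
                      (≤-trans (≰⇒> (nonParallel i≢j)) (r-mono M fifj⊆Y))

    nonParallel-U2Minor : rk M ≡ 2 → (∀ j → NonLoop (f j)) → HasU2Minor M k
    nonParallel-U2Minor rk≡2 nonLoop =
      restriction-U2Minor f nonParallel⇒injective (r≡rankU2-preimage rk≡2 nonLoop)

  module _ (R : ParallelClassRepresentatives) where
    open ParallelClassRepresentatives R

    manyClasses⇒U2Minor : ∀ {k} → rk M ≡ 2 → k ≤ length reps → HasU2Minor M k
    manyClasses⇒U2Minor rk≡2 k≤m =
      nonParallel-U2Minor pick
        (λ i≢j → AllPairs-lookup (λ ¬ab ba → ¬ab (parallel-sym ba)) nonParallel
                                  (i≢j ∘ inject≤-injective _ _ _ _))
        rk≡2 (λ j → All.lookup nonLoop (∈-lookup (inject≤ j k≤m)))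
      where
      pick : Fin _ → Fin n
      pick j = List.lookup reps (inject≤ j k≤m)

    rank≤1-covered : ∀ {X a} → r M X ≤ 1 → 2 ≤ ∣ X ∣ → a ∈ X → NonLoop a →
                     Any (λ F → Covers M F X) (map parallelClass reps)
    rank≤1-covered rX≤1 2≤∣X∣ a∈X nonLoopA with find (represent nonLoopA)
    ... | ρ , ρ∈reps , ρ∥a =
      lose (∈-map⁺ parallelClass ρ∈reps)
           (parallelClass-covers (All.lookup nonLoop ρ∈reps) 2≤∣X∣
                                 (⊆-parallelClass rX≤1 a∈X nonLoopA ρ∥a))

    dependentPair-covered : ∀ {X} → ∣ X ∣ ≡ 2 → r M X ≤ 1 →
                            Any (λ F → Covers M F X) (loops ∷ map parallelClass reps)
    dependentPair-covered {X} ∣X∣≡2 rX≤1 with any? (λ x → (x ∈? X) ×-dec loop? x)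
    ... | yes (x , x∈X , loop) = here (loops-covers x∈X loop)
    ... | no loopFree with nonempty? X
    ...   | no empty = ⊥-elim (0≢1+n (trans (sym (Empty⇒∣p∣≡0 empty)) ∣X∣≡2))
    ...   | yes (a , a∈X) =
      there (rank≤1-covered rX≤1 (≤-reflexive (sym ∣X∣≡2)) a∈X
                            (n≢0⇒n>0 (λ loop → loopFree (a , a∈X , loop))))

    fewClasses⇒κ≤ : ∀ {k} → rk M ≡ 2 → length reps < k → κ≤ M k
    fewClasses⇒κ≤ {k} rk≡2 m<k =
      loops ∷ map parallelClass reps
      , (loops-flat ∷ All.map⁺ (All.map parallelClass-flat nonLoop) , nonBasis-covered)
      , subst (λ m → suc m ≤ k) (sym (length-map parallelClass reps)) m<k
      where
      nonBasis-covered : ∀ X → IsNonBasis M X → Any (λ F → Covers M F X) (loops ∷ map parallelClass reps)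
      nonBasis-covered X nonBasis =
        dependentPair-covered ∣X∣≡2 (s≤s⁻¹ (subst (r M X <_) ∣X∣≡2 (nonBasis⇒r<∣X∣ nonBasis)))
        where
        ∣X∣≡2 : ∣ X ∣ ≡ 2
        ∣X∣≡2 = trans (proj₁ nonBasis) rk≡2

open ParallelClassRepresentatives using (reps)

lemma4p2 : (n k : ℕ) (M : Matroid n) → rk M ≡ 2 → ¬ HasU2Minor M k → κ≤ M k
lemma4p2 n k M rk≡2 noMinor with k ≤? length (reps (representatives M))
... | yes k≤m = ⊥-elim (noMinor (manyClasses⇒U2Minor M (representatives M) rk≡2 k≤m))
... | no k≰m  = fewClasses⇒κ≤ M (representatives M) rk≡2 (≰⇒> k≰m)
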